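{- Let $P$ be the definite logic program (NQUEENS) consisting of the clauses \[ \begin{array}{l} \mathit{pqs}(0,\_,\_,\_).\\ \mathit{pqs}(s(I),Cs,Us,[\_|Ds]) \leftarrow \mathit{pqs}(I,Cs,[\_|Us],Ds),\ \mathit{pq}(s(I),Cs,Us,Ds).\\ \mathit{pq}(I,[I|\_],[I|\_],[I|\_]).\\ \mathit{pq}(I,[\_|Cs],[\_|Us],[\_|Ds]) \leftarrow \mathit{pq}(I,Cs,Us,Ds). \end{array} \] Let $Q_0=\mathit{pqs}(n,t_1,t_2,t_3)$ be a linear query in which $n$ is ground. Then $P$ with $Q_0$ is occur-check free under any selection rule.
   Context: Prolog notation: upper-case identifiers are variables; $0$ a constant, $s$ unary; $[H|T]$ the list constructor; each $\_$ is a distinct fresh variable. An expression is linear if no variable occurs in it more than once. The Martelli–Montanari algorithm (MMA) on a finite set of equations between terms repeatedly and nondeterministically selects an equation of one of the following forms and performs the action: (1) $f(s_1,\dots,s_n)=f(t_1,\dots,t_n)$: replace it by $s_1=t_1,\dots,s_n=t_n$; (2) $f(s_1,\dots,s_n)=g(t_1,\dots,t_m)$ with $f\neq g$: halt with failure; (3) $X=X$: delete it; (4) $t=X$ with $t$ not a variable: replace by $X=t$; (5) $X=t$ with $X\notin\mathrm{Var}(t)$ and $X$ occurring elsewhere: apply the substitution $\{X/t\}$ to all other equations; (6) $X=t$ with $X\in\mathrm{Var}(t)$ and $X\neq t$: halt with failure. It stops with success when no action applies. An equation set $E$ is NSTO (not subject to occur-check) if no run of MMA on $E$ performs action (6). In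 an SLD-derivation (or tree) for program $P$, the unification of $A$ and $H$ (i.e. the equation set $\{A=H\}$) is available if $A$ is the selected atom of some query and $H$ is a standardized-apart head of a clause of $P$ with the same predicate symbol as $A$. An SLD-derivation is occur-check free if all unifications available in it are NSTO; $P$ with query $Q$ is occur-check free under a selection rule if all SLD-derivations for $P$ with $Q$ under that rule are occur-check free. -}

module Defs where

open import Data.Nat using (ℕ; _≟_)
open import Data.List using (List; []; _∷_; _++_; length; zip; concatMap)
open import Data.List.Membership.Propositional using (_∈_)
open import Data.List.Relation.Unary.Any using (Any)
open import Data.List.Relation.Unary.Unique.Propositional using (Unique)
open import Data.Product using (_×_; _,_; Σ; ∃; ∃-syntax)
open import Relation.Nullary using (¬_; yes; no)
open import Relation.Binary.PropositionalEquality using (_≡_; _≢_)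
open import Relation.Binary.Construct.Closure.ReflexiveTransitive using (Star)
open import Function.Definitions using (Injective)

-- Variables are indexed by ℕ; a function symbol is
-- a name (ℕ) together with its arity (the length of the argument list):
-- fn f ss and fn f ts denote the same functor iff length ss ≡ length ts.
-- Atoms are represented as terms whose head symbol is the predicate.

data Term : Set where
  var : ℕ → Term
  fn  : ℕ → List Term → Term

mutual
  vars : Term → List ℕ
  vars (var x)   = x ∷ []
  vars (fn f ts) = varsL ts

  varsL : List Term → List ℕ
  varsL []       = []
  varsL (t ∷ ts) = vars t ++ varsL ts

Ground : Term → Set
Ground t = vars t ≡ []

Linear : Term → Set
Linear t = Unique (vars t)

IsNonVar : Term → Set
IsNonVar t = ∃[ f ] ∃[ ts ] (t ≡ fn f ts)

Subst : Set
Subst = ℕ → Term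

mutual
  apply : Subst → Term → Term
  apply σ (var x)   = σ x
  apply σ (fn f ts) = fn f (applyL σ ts)

  applyL : Subst → List Term → List Term
  applyL σ []       = []
  applyL σ (t ∷ ts) = apply σ t ∷ applyL σ ts

single : ℕ → Term → Subst
single x t y with x ≟ y
... | yes _ = t
... | no _  = var y

Eqn : Set
Eqn = Term × Term

varsE : List Eqn → List ℕ
varsE [] = []
varsE ((s , t) ∷ es) = vars s ++ vars t ++ varsE es

applyE : Subst → List Eqn → List Eqn
applyE σ [] = []
applyE σ ((s , t) ∷ es) = (apply σ s , apply σ t) ∷ applyE σ es

-- one non-halting MMA action (1), (3), (4) or (5), on the selected
-- equation at any position
data MMAStep : List Eqn → List Eqn → Set where
  decompose : ∀ pre post f ss ts → length ss ≡ length ts →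
    MMAStep (pre ++ (fn f ss , fn f ts) ∷ post) (pre ++ zip ss ts ++ post)
  delete : ∀ pre post x →
    MMAStep (pre ++ (var x , var x) ∷ post) (pre ++ post)
  swap : ∀ pre post t x → IsNonVar t →
    MMAStep (pre ++ (t , var x) ∷ post) (pre ++ (var x , t) ∷ post)
  eliminate : ∀ pre post x t → ¬ (x ∈ vars t) → x ∈ varsE (pre ++ post) →
    MMAStep (pre ++ (var x , t) ∷ post)
            (applyE (single x t) pre ++ (var x , t) ∷ applyE (single x t) post)

Action6Applicable : List Eqn → Set
Action6Applicable E =
  Any (λ e → ∃[ x ] ∃[ t ] (e ≡ (var x , t) × x ∈ vars t × t ≢ var x)) E

NSTO : List Eqn → Set
NSTO E = ∀ E' → Star MMAStep E E' → ¬ Action6Applicable E'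

record Clause : Set where
  constructor _←_
  field
    head : Term
    body : List Term
open Clause public

Program : Set
Program = List Clause

Query : Set
Query = List Term

rename : (ℕ → ℕ) → Clause → Clause
rename ρ (h ← b) = apply (λ x → var (ρ x)) h ← applyL (λ x → var (ρ x)) b

varsC : Clause → List ℕ
varsC (h ← b) = vars h ++ varsL b

Apart : Clause → List Query → Set
Apart c hist = ∀ x → x ∈ varsC c → ∀ Q → Q ∈ hist → ¬ (x ∈ varsL Q)

Unifier : Subst → Term → Term → Set
Unifier θ s t = apply θ s ≡ apply θ t

MGU : Subst → Term → Term → Set
MGU θ s t = Unifier θ s t ×
  (∀ σ → Unifier σ s t → ∃[ η ] (∀ x → σ x ≡ apply η (θ x)))

SamePred : Term → Term → Set
SamePred A H = ∃[ p ] ∃[ as ] ∃[ hs ]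
  (A ≡ fn p as × H ≡ fn p hs × length as ≡ length hs)

-- Deriv P Q0 (Qk ∷ … ∷ Q0 ∷ []) : Q0, …, Qk are the queries of an
-- SLD-derivation of P with Q0, where at every step the selected atom is
-- arbitrary (any selection rule), the clause variant is standardized apart
-- from all previous queries, and θ is any mgu.
data Deriv (P : Program) (Q0 : Query) : List Query → Set where
  start : Deriv P Q0 (Q0 ∷ [])
  step  : ∀ {Q hist} → Deriv P Q0 (Q ∷ hist) →
    ∀ pre A post c ρ θ → c ∈ P → Injective _≡_ _≡_ ρ →
    Q ≡ pre ++ A ∷ post →
    Apart (rename ρ c) (Q ∷ hist) →
    MGU θ A (head (rename ρ c)) →
    Deriv P Q0 (applyL θ (pre ++ body (rename ρ c) ++ post) ∷ Q ∷ hist)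

OccurCheckFree : Program → Query → Set
OccurCheckFree P Q0 = ∀ Q hist → Deriv P Q0 (Q ∷ hist) →
  ∀ A → A ∈ Q → ∀ c → c ∈ P → ∀ ρ → Injective _≡_ _≡_ ρ →
  Apart (rename ρ c) (Q ∷ hist) → SamePred A (head (rename ρ c)) →
  NSTO ((A , head (rename ρ c)) ∷ [])

zeroS sS consS pqsS pqS : ℕ
zeroS = 0
sS    = 1
consS = 2
pqsS  = 3
pqS   = 4

z : Term
z = fn zeroS []

s : Term → Term
s t = fn sS (t ∷ [])

[_∣_] : Term → Term → Term
[ h ∣ t ] = fn consS (h ∷ t ∷ [])

pqs pq : Term → Term → Term → Term → Term
pqs a b c d = fn pqsS (a ∷ b ∷ c ∷ d ∷ [])
pq  a b c d = fn pqS  (a ∷ b ∷ c ∷ d ∷ [])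

clause1 : Clause
clause1 = pqs z (var 0) (var 1) (var 2) ← []

-- pqs(s(I),Cs,Us,[_|Ds]) ← pqs(I,Cs,[_|Us],Ds), pq(s(I),Cs,Us,Ds).
-- I=0, Cs=1, Us=2, _=3, Ds=4, _=5
clause2 : Clause
clause2 = pqs (s (var 0)) (var 1) (var 2) [ var 3 ∣ var 4 ]
        ← (pqs (var 0) (var 1) [ var 5 ∣ var 2 ] (var 4)
           ∷ pq (s (var 0)) (var 1) (var 2) (var 4) ∷ [])

clause3 : Clause
clause3 = pq (var 0) [ var 0 ∣ var 1 ] [ var 0 ∣ var 2 ] [ var 0 ∣ var 3 ] ← []

-- pq(I,[_|Cs],[_|Us],[_|Ds]) ← pq(I,Cs,Us,Ds).
-- I=0, _=1, Cs=2, _=3, Us=4, _=5, Ds=6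
clause4 : Clause
clause4 = pq (var 0) [ var 1 ∣ var 2 ] [ var 3 ∣ var 4 ] [ var 5 ∣ var 6 ]
        ← (pq (var 0) (var 2) (var 4) (var 6) ∷ [])

nqueens : Program
nqueens = clause1 ∷ clause2 ∷ clause3 ∷ clause4 ∷ []

module Submission where

-- Every atom of every query of an SLD-derivation stays linear with a ground first (input)
-- argument.  In a resolution step the first argument of the selected atom is ground, so
-- every unifier with a clause head sends the head's input variable I to one fixed ground
-- term; after substituting it, the head becomes linear (only I repeats, in the head of the
-- third clause).  Unifying a linear atom with a variable-disjoint linear term gives, up to
-- renaming, a substitution mapping distinct variables to variable-disjoint terms, hence it
-- keeps the remaining atoms of the query and the new body atoms linear.  Finally, an
-- equation A = H with A linear and variable-disjoint from H is NSTO: during any run of the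
-- Martelli–Montanari algorithm the equations can be oriented so that no variable occurs
-- twice on the left or on both sides, whereas action (6) needs a variable on both sides.

open import Defs

open import Data.Empty using (⊥; ⊥-elim)
open import Data.Nat using (ℕ; zero; suc; pred; _+_; _*_; _≤_; _<_; z≤n; s≤s; _≟_)
open import Data.Nat.Properties
  using (module ≤-Reasoning; ≤-refl; ≤-trans; ≤-reflexive; ≤-pred; +-mono-≤; +-monoˡ-≤; +-monoʳ-≤;
         m≤m+n; m≤n+m; n≤0⇒n≡0; m+n≡0⇒n≡0; m+n≤o⇒n≤o; +-identityʳ; +-comm; +-assoc;
         *-zeroʳ; *-identityʳ; *-distribʳ-+)
open import Data.Nat.Solver using (module +-*-Solver)
open import Data.List using (List; []; _∷_; [_]; _++_; map; zip; length; concatMap; filter)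
open import Data.List.Properties
  using (++-identityʳ; ++-assoc; map-++; concatMap-++; concatMap-map; concatMap-pure; filter-accept; filter-reject; ∷-injectiveˡ; ∷-injectiveʳ)
open import Data.List.Membership.Propositional using (_∈_; _∉_; find)
open import Data.List.Membership.Propositional.Properties
  using (∈-++⁺ˡ; ∈-++⁺ʳ; ∈-++⁻; ∈-map⁺; ∈-map⁻; ∈-concatMap⁺; ∈-concatMap⁻)
open import Data.List.Membership.DecPropositional _≟_ using (_∈?_)
open import Data.List.Relation.Binary.Pointwise using (Pointwise; []; _∷_; ++⁺)
open import Data.List.Relation.Binary.Subset.Propositional using (_⊆_)
open import Data.List.Relation.Unary.All using (All; []; _∷_)
import Data.List.Relation.Unary.All as All
open import Data.List.Relation.Unary.AllPairs using ([]; _∷_)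
open import Data.List.Relation.Unary.Any using (here; there)
import Data.List.Relation.Unary.Any as Any
open import Data.List.Relation.Unary.Unique.Propositional using (Unique)
open import Data.List.Relation.Unary.Unique.Propositional.Properties using (Unique[x∷xs]⇒x∉xs)
import Data.List.Relation.Unary.Unique.Propositional.Properties as Unique
open import Data.List.Relation.Unary.Unique.DecPropositional _≟_ using (unique?)
open import Data.Product using (_×_; _,_; ∃-syntax; proj₁; proj₂) renaming (swap to flip)
import Data.Product as Product
open import Data.Sum using (_⊎_; inj₁; inj₂)
import Data.Sum as Sum
open import Function using (_∘_; case_of_)
open import Function.Definitions using (Injective)
open import Relation.Binary.Construct.Closure.ReflexiveTransitive using (Star; ε; _◅_)
open import Relation.Binary.PropositionalEquality
  using (_≡_; _≢_; refl; sym; trans; cong; cong₂; subst; module ≡-Reasoning)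
open import Relation.Nullary using (¬_; ¬?; yes; no)
open import Relation.Nullary.Decidable using (True; toWitness; from-yes)

occ : ℕ → List ℕ → ℕ
occ w [] = 0
occ w (v ∷ vs) with w ≟ v
... | yes _ = suc (occ w vs)
... | no  _ = occ w vs

AtMostOnce : List ℕ → Set
AtMostOnce vs = ∀ w → occ w vs ≤ 1

occ-++ : ∀ w xs ys → occ w (xs ++ ys) ≡ occ w xs + occ w ys
occ-++ w [] ys = refl
occ-++ w (v ∷ xs) ys with w ≟ v
... | yes _ = cong suc (occ-++ w xs ys)
... | no  _ = occ-++ w xs ys

occ-[_] : ∀ w → occ w (w ∷ []) ≡ 1
occ-[ w ] with w ≟ w
... | yes _ = refl
... | no w≢w = ⊥-elim (w≢w refl)

occ-[≢] : ∀ {w v} → w ≢ v → occ w (v ∷ []) ≡ 0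
occ-[≢] {w} {v} w≢v with w ≟ v
... | yes w≡v = ⊥-elim (w≢v w≡v)
... | no  _   = refl

∈⇒occ>0 : ∀ {w xs} → w ∈ xs → 0 < occ w xs
∈⇒occ>0 {w} {v ∷ xs} w∈ with w ≟ v | w∈
... | yes _   | _          = s≤s z≤n
... | no  w≢v | here w≡v   = ⊥-elim (w≢v w≡v)
... | no  _   | there w∈xs = ∈⇒occ>0 w∈xs

occ>0⇒∈ : ∀ {w} xs → 0 < occ w xs → w ∈ xs
occ>0⇒∈ {w} (v ∷ xs) pos with w ≟ v
... | yes w≡v = here w≡v
... | no  _   = there (occ>0⇒∈ xs pos)

∉⇒occ≡0 : ∀ {w} xs → w ∉ xs → occ w xs ≡ 0
∉⇒occ≡0 [] _ = refl
∉⇒occ≡0 {w} (v ∷ xs) w∉ with w ≟ v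
... | yes w≡v = ⊥-elim (w∉ (here w≡v))
... | no  _   = ∉⇒occ≡0 xs (w∉ ∘ there)

occ≡0⇒∉ : ∀ {w xs} → occ w xs ≡ 0 → w ∉ xs
occ≡0⇒∉ eq w∈ with ∈⇒occ>0 w∈
... | pos rewrite eq = 1≰0 pos
  where 1≰0 : ¬ (1 ≤ 0)
        1≰0 ()

occ≡0⊎occ>0 : ∀ w xs → occ w xs ≡ 0 ⊎ 0 < occ w xs
occ≡0⊎occ>0 w xs with occ w xs
... | zero  = inj₁ refl
... | suc _ = inj₂ (s≤s z≤n)

2≰1 : ¬ (2 ≤ 1)
2≰1 (s≤s ())

AtMostOnce-[_] : ∀ v → AtMostOnce (v ∷ [])
AtMostOnce-[ v ] w with w ≟ v
... | yes _ = s≤s z≤n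
... | no  _ = z≤n

Unique⇒AtMostOnce : ∀ {xs} → Unique xs → AtMostOnce xs
Unique⇒AtMostOnce [] w = z≤n
Unique⇒AtMostOnce {v ∷ xs} u@(_ ∷ u′) w with w ≟ v
... | no  _    = Unique⇒AtMostOnce u′ w
... | yes refl = s≤s (subst (_≤ 0) (sym (∉⇒occ≡0 xs (Unique[x∷xs]⇒x∉xs u))) z≤n)

AtMostOnce-++ˡ : ∀ xs {ys} → AtMostOnce (xs ++ ys) → AtMostOnce xs
AtMostOnce-++ˡ xs {ys} lin w = ≤-trans (m≤m+n _ _) (subst (_≤ 1) (occ-++ w xs ys) (lin w))

AtMostOnce-++ʳ : ∀ xs {ys} → AtMostOnce (xs ++ ys) → AtMostOnce ys
AtMostOnce-++ʳ xs {ys} lin w = ≤-trans (m≤n+m _ _) (subst (_≤ 1) (occ-++ w xs ys) (lin w))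

AtMostOnce-++-disjoint : ∀ xs {ys} → AtMostOnce (xs ++ ys) → ∀ {w} → w ∈ xs → w ∉ ys
AtMostOnce-++-disjoint xs {ys} lin {w} w∈xs w∈ys = 2≰1 (begin
  2                         ≤⟨ +-mono-≤ (∈⇒occ>0 w∈xs) (∈⇒occ>0 w∈ys) ⟩
  occ w xs + occ w ys       ≡⟨ occ-++ w xs ys ⟨
  occ w (xs ++ ys)          ≤⟨ lin w ⟩
  1                         ∎)
  where open ≤-Reasoning

occ-++-middle : ∀ w xs ys zs → occ w (xs ++ ys ++ zs) ≡ occ w ys + occ w (xs ++ zs)
occ-++-middle w xs ys zs = begin
  occ w (xs ++ ys ++ zs)           ≡⟨ occ-++ w xs (ys ++ zs) ⟩
  occ w xs + occ w (ys ++ zs)      ≡⟨ cong (occ w xs +_) (occ-++ w ys zs) ⟩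
  occ w xs + (occ w ys + occ w zs) ≡⟨ solve 3 (λ a b c → a :+ (b :+ c) := b :+ (a :+ c)) refl (occ w xs) (occ w ys) (occ w zs) ⟩
  occ w ys + (occ w xs + occ w zs) ≡⟨ cong (occ w ys +_) (sym (occ-++ w xs zs)) ⟩
  occ w ys + occ w (xs ++ zs)      ∎
  where open ≡-Reasoning
        open +-*-Solver

occ-∷-≢ : ∀ {w v} vs → w ≢ v → occ w (v ∷ vs) ≡ occ w vs
occ-∷-≢ {w} {v} vs w≢v with w ≟ v
... | yes w≡v = ⊥-elim (w≢v w≡v)
... | no  _   = refl

occ-map : ∀ {ρ : ℕ → ℕ} → Injective _≡_ _≡_ ρ → ∀ i xs → occ (ρ i) (map ρ xs) ≡ occ i xs
occ-map         ρ-inj i []       = refl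
occ-map {ρ = ρ} ρ-inj i (v ∷ xs) with ρ i ≟ ρ v | i ≟ v
... | yes _      | yes _   = cong suc (occ-map ρ-inj i xs)
... | yes ρi≡ρv  | no  i≢v = ⊥-elim (i≢v (ρ-inj ρi≡ρv))
... | no  ρi≢ρv  | yes i≡v = ⊥-elim (ρi≢ρv (cong ρ i≡v))
... | no  _      | no  _   = occ-map ρ-inj i xs

occ-concatMap-≥ : ∀ (h : ℕ → List ℕ) v y ys → occ y ys * occ v (h y) ≤ occ v (concatMap h ys)
occ-concatMap-≥ h v y []       = z≤n
occ-concatMap-≥ h v y (z ∷ ys) with y ≟ z
... | yes refl = ≤-trans (+-monoʳ-≤ (occ v (h y)) (occ-concatMap-≥ h v y ys)) (≤-reflexive (sym (occ-++ v (h y) _)))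
... | no  _    = ≤-trans (occ-concatMap-≥ h v y ys) (≤-trans (m≤n+m _ _) (≤-reflexive (sym (occ-++ v (h z) _))))

concatMap-AtMostOnce : ∀ (f : ℕ → List ℕ) xs → AtMostOnce xs → (∀ {v} → v ∈ xs → AtMostOnce (f v)) →
  (∀ {v₁ v₂ w} → v₁ ∈ xs → v₂ ∈ xs → v₁ ≢ v₂ → w ∈ f v₁ → w ∉ f v₂) → AtMostOnce (concatMap f xs)
concatMap-AtMostOnce f []       _   _     _      w = z≤n
concatMap-AtMostOnce f (x ∷ xs) lin f-lin f-disj w with occ≡0⊎occ>0 w (f x)
... | inj₁ w∉fx = subst (_≤ 1) (sym (trans (occ-++ w (f x) _) (cong (_+ _) w∉fx)))
      (concatMap-AtMostOnce f xs (AtMostOnce-++ʳ (x ∷ []) lin) (f-lin ∘ there)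
        (λ v₁∈ v₂∈ → f-disj (there v₁∈) (there v₂∈)) w)
... | inj₂ w∈fx = subst (_≤ 1) (sym (trans (occ-++ w (f x) _) (trans (cong (occ w (f x) +_) rest≡0) (+-identityʳ _))))
      (f-lin (here refl) w)
  where
    rest≡0 : occ w (concatMap f xs) ≡ 0
    rest≡0 = ∉⇒occ≡0 _ λ w∈ → let v , v∈xs , w∈fv = find (∈-concatMap⁻ f w∈) in
      f-disj (here refl) (there v∈xs) (λ { refl → AtMostOnce-++-disjoint (x ∷ []) lin (here refl) v∈xs })
             (occ>0⇒∈ (f x) w∈fx) w∈fv

AtMostOnceExcept : ℕ → List ℕ → Set
AtMostOnceExcept x vs = ∀ w → w ≢ x → occ w vs ≤ 1

AtMostOnceExcept-filter : ∀ x xs → AtMostOnce (filter (λ v → ¬? (v ≟ x)) xs) → AtMostOnceExcept x xs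
AtMostOnceExcept-filter x xs lin w w≢x = subst (_≤ 1) (occ-filter xs) (lin w)
  where
    occ-∷ : ∀ v {ys zs} → occ w ys ≡ occ w zs → occ w (v ∷ ys) ≡ occ w (v ∷ zs)
    occ-∷ v eq with w ≟ v
    ... | yes _ = cong suc eq
    ... | no  _ = eq

    occ-filter : ∀ xs → occ w (filter (λ v → ¬? (v ≟ x)) xs) ≡ occ w xs
    occ-filter []       = refl
    occ-filter (v ∷ xs) with v ≟ x
    ... | yes refl = begin
      occ w (filter (λ v → ¬? (v ≟ x)) (x ∷ xs)) ≡⟨ cong (occ w) (filter-reject (λ v → ¬? (v ≟ x)) (λ x≢x → x≢x refl)) ⟩
      occ w (filter (λ v → ¬? (v ≟ x)) xs)       ≡⟨ occ-filter xs ⟩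
      occ w xs                                   ≡⟨ occ-∷-≢ xs w≢x ⟨
      occ w (x ∷ xs)                             ∎
      where open ≡-Reasoning
    ... | no v≢x = trans (cong (occ w) (filter-accept (λ v → ¬? (v ≟ x)) v≢x)) (occ-∷ v (occ-filter xs))

AtMostOnceExcept-map : ∀ {ρ : ℕ → ℕ} → Injective _≡_ _≡_ ρ → ∀ {x xs} →
  AtMostOnceExcept x xs → AtMostOnceExcept (ρ x) (map ρ xs)
AtMostOnceExcept-map {ρ} ρ-inj {x} {xs} lin w w≢ρx with w ∈? map ρ xs
... | no  w∉ = subst (_≤ 1) (sym (∉⇒occ≡0 _ w∉)) z≤n
... | yes w∈ with ∈-map⁻ ρ w∈
...   | i , _ , refl = subst (_≤ 1) (sym (occ-map ρ-inj i xs)) (lin i (λ { refl → w≢ρx refl }))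

⊆[]⇒≡[] : ∀ {xs : List ℕ} → xs ⊆ [] → xs ≡ []
⊆[]⇒≡[] {[]}    _   = refl
⊆[]⇒≡[] {_ ∷ _} ⊆[] = case ⊆[] (here refl) of λ ()

fn-injective : ∀ {f g ss ts} → fn f ss ≡ fn g ts → f ≡ g × ss ≡ ts
fn-injective refl = refl , refl

mutual
  vars-apply : ∀ σ t → vars (apply σ t) ≡ concatMap (vars ∘ σ) (vars t)
  vars-apply σ (var x)   = sym (++-identityʳ (vars (σ x)))
  vars-apply σ (fn f ts) = varsL-applyL σ ts

  varsL-applyL : ∀ σ ts → varsL (applyL σ ts) ≡ concatMap (vars ∘ σ) (varsL ts)
  varsL-applyL σ []       = refl
  varsL-applyL σ (t ∷ ts) = begin
    vars (apply σ t) ++ varsL (applyL σ ts)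
      ≡⟨ cong₂ _++_ (vars-apply σ t) (varsL-applyL σ ts) ⟩
    concatMap (vars ∘ σ) (vars t) ++ concatMap (vars ∘ σ) (varsL ts)
      ≡⟨ sym (concatMap-++ (vars ∘ σ) (vars t) (varsL ts)) ⟩
    concatMap (vars ∘ σ) (vars t ++ varsL ts) ∎
    where open ≡-Reasoning

varsL-++ : ∀ ts us → varsL (ts ++ us) ≡ varsL ts ++ varsL us
varsL-++ []       us = refl
varsL-++ (t ∷ ts) us = trans (cong (vars t ++_) (varsL-++ ts us)) (sym (++-assoc (vars t) _ _))

vars-rename : ∀ ρ t → vars (apply (var ∘ ρ) t) ≡ map ρ (vars t)
vars-rename ρ t = begin
  vars (apply (var ∘ ρ) t)          ≡⟨ vars-apply (var ∘ ρ) t ⟩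
  concatMap ([_] ∘ ρ) (vars t)      ≡⟨ concatMap-map [_] ρ (vars t) ⟨
  concatMap [_] (map ρ (vars t))    ≡⟨ concatMap-pure (map ρ (vars t)) ⟩
  map ρ (vars t)                    ∎
  where open ≡-Reasoning

mutual
  apply-cong : ∀ {σ τ} t → (∀ x → x ∈ vars t → σ x ≡ τ x) → apply σ t ≡ apply τ t
  apply-cong (var x)   σ≗τ = σ≗τ x (here refl)
  apply-cong (fn f ts) σ≗τ = cong (fn f) (applyL-cong ts σ≗τ)

  applyL-cong : ∀ {σ τ} ts → (∀ x → x ∈ varsL ts → σ x ≡ τ x) → applyL σ ts ≡ applyL τ ts
  applyL-cong []       σ≗τ = refl
  applyL-cong (t ∷ ts) σ≗τ =
    cong₂ _∷_ (apply-cong t (λ x → σ≗τ x ∘ ∈-++⁺ˡ)) (applyL-cong ts (λ x → σ≗τ x ∘ ∈-++⁺ʳ (vars t)))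

mutual
  apply-var : ∀ t → apply var t ≡ t
  apply-var (var x)   = refl
  apply-var (fn f ts) = cong (fn f) (applyL-var ts)

  applyL-var : ∀ ts → applyL var ts ≡ ts
  applyL-var []       = refl
  applyL-var (t ∷ ts) = cong₂ _∷_ (apply-var t) (applyL-var ts)

mutual
  apply-∘ : ∀ σ τ t → apply σ (apply τ t) ≡ apply (apply σ ∘ τ) t
  apply-∘ σ τ (var x)   = refl
  apply-∘ σ τ (fn f ts) = cong (fn f) (applyL-∘ σ τ ts)

  applyL-∘ : ∀ σ τ ts → applyL σ (applyL τ ts) ≡ applyL (apply σ ∘ τ) ts
  applyL-∘ σ τ []       = refl
  applyL-∘ σ τ (t ∷ ts) = cong₂ _∷_ (apply-∘ σ τ t) (applyL-∘ σ τ ts)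

apply-fixes : ∀ σ t → (∀ x → x ∈ vars t → σ x ≡ var x) → apply σ t ≡ t
apply-fixes σ t σx≡x = trans (apply-cong t σx≡x) (apply-var t)

apply-ground : ∀ σ g → Ground g → apply σ g ≡ g
apply-ground σ g g-ground = apply-fixes σ g λ x x∈ → ⊥-elim (no-var (subst (x ∈_) g-ground x∈))
  where no-var : ∀ {x} → x ∉ []
        no-var ()

∉-ground : ∀ {w} r → Ground r → w ∉ vars r
∉-ground {w} r r-ground w∈ = case subst (w ∈_) r-ground w∈ of λ ()

vars-⊆-varsL : ∀ {B} Q → B ∈ Q → vars B ⊆ varsL Q
vars-⊆-varsL (B ∷ Q)  (here refl) = ∈-++⁺ˡ
vars-⊆-varsL (B′ ∷ Q) (there B∈)  = ∈-++⁺ʳ (vars B′) ∘ vars-⊆-varsL Q B∈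

All-applyL : ∀ {P : Term → Set} θ ts → (∀ {t} → t ∈ ts → P (apply θ t)) → All P (applyL θ ts)
All-applyL θ []       _ = []
All-applyL θ (t ∷ ts) P = P (here refl) ∷ All-applyL θ ts (P ∘ there)

headVars⊆ : ∀ c → vars (head c) ⊆ varsC c
headVars⊆ (h ← b) = ∈-++⁺ˡ

mutual
  apply-agree-on-vars : ∀ {σ τ} t → apply σ t ≡ apply τ t → ∀ {x} → x ∈ vars t → σ x ≡ τ x
  apply-agree-on-vars (var y)   σt≡τt (here refl) = σt≡τt
  apply-agree-on-vars (fn f ts) σt≡τt x∈          = applyL-agree-on-vars ts (proj₂ (fn-injective σt≡τt)) x∈

  applyL-agree-on-vars : ∀ {σ τ} ts → applyL σ ts ≡ applyL τ ts → ∀ {x} → x ∈ varsL ts → σ x ≡ τ x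
  applyL-agree-on-vars (t ∷ ts) eq x∈ with ∈-++⁻ (vars t) x∈
  ... | inj₁ x∈t  = apply-agree-on-vars  t  (∷-injectiveˡ eq) x∈t
  ... | inj₂ x∈ts = applyL-agree-on-vars ts (∷-injectiveʳ eq) x∈ts

vars-image-⊆ : ∀ σ t {x} → x ∈ vars t → vars (σ x) ⊆ vars (apply σ t)
vars-image-⊆ σ t x∈ w∈ = subst (_ ∈_) (sym (vars-apply σ t)) (∈-concatMap⁺ (vars ∘ σ) (Any.map (λ { refl → w∈ }) x∈))

apply≡var : ∀ η s {x} → apply η s ≡ var x → ∃[ w ] (s ≡ var w × η w ≡ var x)
apply≡var η (var w) ηw≡x = w , refl , ηw≡x

mutual
  left-inverse-on-vars : ∀ η θ t → apply η (apply θ t) ≡ t → ∀ {v} → v ∈ vars t → ∃[ w ] (θ v ≡ var w × η w ≡ var v)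
  left-inverse-on-vars η θ (var x)   inv (here refl) = apply≡var η (θ x) inv
  left-inverse-on-vars η θ (fn f ts) inv v∈          = left-inverse-on-varsL η θ ts (proj₂ (fn-injective inv)) v∈

  left-inverse-on-varsL : ∀ η θ ts → applyL η (applyL θ ts) ≡ ts → ∀ {v} → v ∈ varsL ts → ∃[ w ] (θ v ≡ var w × η w ≡ var v)
  left-inverse-on-varsL η θ (t ∷ ts) inv v∈ with ∈-++⁻ (vars t) v∈
  ... | inj₁ v∈t  = left-inverse-on-vars  η θ t  (∷-injectiveˡ inv) v∈t
  ... | inj₂ v∈ts = left-inverse-on-varsL η θ ts (∷-injectiveʳ inv) v∈ts

renaming-AtMostOnce : ∀ η θ t → apply η (apply θ t) ≡ t → AtMostOnce (vars t) → AtMostOnce (vars (apply θ t))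
renaming-AtMostOnce η θ t inv t-lin y with occ≡0⊎occ>0 y (vars (apply θ t))
... | inj₁ y∉ = subst (_≤ 1) (sym y∉) z≤n
... | inj₂ y∈
  with find (∈-concatMap⁻ (vars ∘ θ) (subst (y ∈_) (vars-apply θ t) (occ>0⇒∈ _ y∈)))
...   | v , v∈t , y∈θv with left-inverse-on-vars η θ t inv v∈t
...     | w , θv≡w , ηw≡v with subst (λ s → y ∈ vars s) θv≡w y∈θv
...       | here refl = begin
  occ w ys                                ≡⟨ *-identityʳ (occ w ys) ⟨
  occ w ys * 1                            ≡⟨ cong (occ w ys *_) (trans (sym occ-[ v ]) (cong (occ v ∘ vars) (sym ηw≡v))) ⟩
  occ w ys * occ v (vars (η w))           ≤⟨ occ-concatMap-≥ (vars ∘ η) v w ys ⟩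
  occ v (concatMap (vars ∘ η) ys)         ≡⟨ cong (occ v) (trans (sym (vars-apply η (apply θ t))) (cong vars inv)) ⟩
  occ v (vars t)                          ≤⟨ t-lin v ⟩
  1                                       ∎
  where open ≤-Reasoning
        ys = vars (apply θ t)

module _ {x : ℕ} (t : Term) where

  private
    k : ℕ → ℕ
    k w = occ w (vars t)

  occ-single-var : ∀ {w} → w ≢ x → ∀ v → occ w (vars (single x t v)) ≡ occ w [ v ] + occ x [ v ] * k w
  occ-single-var {w} w≢x v with x ≟ v
  ... | yes refl rewrite occ-[≢] w≢x = sym (+-identityʳ (k w))
  ... | no  _    = sym (+-identityʳ _)

  occ-single-var-self : ∀ v → occ x (vars (single x t v)) ≡ occ x [ v ] * k x
  occ-single-var-self v with x ≟ v
  ... | yes refl = sym (+-identityʳ (k x))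
  ... | no  x≢v  = occ-[≢] x≢v

  occ-substitute : ∀ {w} → w ≢ x → ∀ xs →
    occ w (concatMap (vars ∘ single x t) xs) ≡ occ w xs + occ x xs * k w
  occ-substitute w≢x [] = refl
  occ-substitute {w} w≢x (v ∷ xs) = begin
    occ w (vars (single x t v) ++ concatMap (vars ∘ single x t) xs)
      ≡⟨ occ-++ w (vars (single x t v)) _ ⟩
    occ w (vars (single x t v)) + occ w (concatMap (vars ∘ single x t) xs)
      ≡⟨ cong₂ _+_ (occ-single-var w≢x v) (occ-substitute w≢x xs) ⟩
    (occ w [ v ] + occ x [ v ] * k w) + (occ w xs + occ x xs * k w)
      ≡⟨ solve 5 (λ a b c d e → (a :+ b :* e) :+ (c :+ d :* e) := (a :+ c) :+ (b :+ d) :* e) refl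
           (occ w [ v ]) (occ x [ v ]) (occ w xs) (occ x xs) (k w) ⟩
    (occ w [ v ] + occ w xs) + (occ x [ v ] + occ x xs) * k w
      ≡⟨ sym (cong₂ (λ m n → m + n * k w) (occ-++ w [ v ] xs) (occ-++ x [ v ] xs)) ⟩
    occ w (v ∷ xs) + occ x (v ∷ xs) * k w ∎
    where open ≡-Reasoning
          open +-*-Solver

  occ-substitute-self : ∀ xs → occ x (concatMap (vars ∘ single x t) xs) ≡ occ x xs * k x
  occ-substitute-self [] = refl
  occ-substitute-self (v ∷ xs) = begin
    occ x (vars (single x t v) ++ concatMap (vars ∘ single x t) xs)
      ≡⟨ occ-++ x (vars (single x t v)) _ ⟩
    occ x (vars (single x t v)) + occ x (concatMap (vars ∘ single x t) xs)
      ≡⟨ cong₂ _+_ (occ-single-var-self v) (occ-substitute-self xs) ⟩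
    occ x [ v ] * k x + occ x xs * k x
      ≡⟨ sym (*-distribʳ-+ (k x) (occ x [ v ]) (occ x xs)) ⟩
    (occ x [ v ] + occ x xs) * k x
      ≡⟨ sym (cong (_* k x) (occ-++ x [ v ] xs)) ⟩
    occ x (v ∷ xs) * k x ∎
    where open ≡-Reasoning

-- The Martelli–Montanari algorithm on a linear term and a variable-disjoint term

applyE-++ : ∀ σ E F → applyE σ (E ++ F) ≡ applyE σ E ++ applyE σ F
applyE-++ σ []      F = refl
applyE-++ σ (e ∷ E) F = cong (_ ∷_) (applyE-++ σ E F)

sideVars : (Eqn → Term) → List Eqn → List ℕ
sideVars side E = varsL (map side E)

lhsVars rhsVars : List Eqn → List ℕ
lhsVars = sideVars proj₁
rhsVars = sideVars proj₂

sideVars-++ : ∀ side E F → sideVars side (E ++ F) ≡ sideVars side E ++ sideVars side F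
sideVars-++ side E F = trans (cong varsL (map-++ side E F)) (varsL-++ (map side E) (map side F))

occ-sideVars-middle : ∀ side w pre M post →
  occ w (sideVars side (pre ++ M ++ post)) ≡ occ w (sideVars side M) + occ w (sideVars side (pre ++ post))
occ-sideVars-middle side w pre M post = begin
  occ w (sideVars side (pre ++ M ++ post))
    ≡⟨ cong (occ w) (trans (sideVars-++ side pre (M ++ post)) (cong (sideVars side pre ++_) (sideVars-++ side M post))) ⟩
  occ w (sideVars side pre ++ sideVars side M ++ sideVars side post)
    ≡⟨ occ-++-middle w (sideVars side pre) (sideVars side M) (sideVars side post) ⟩
  occ w (sideVars side M) + occ w (sideVars side pre ++ sideVars side post)
    ≡⟨ cong (λ vs → occ w (sideVars side M) + occ w vs) (sym (sideVars-++ side pre post)) ⟩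
  occ w (sideVars side M) + occ w (sideVars side (pre ++ post)) ∎
  where open ≡-Reasoning

occ-sideVars-focus : ∀ side w pre e post →
  occ w (sideVars side (pre ++ e ∷ post)) ≡ occ w (vars (side e)) + occ w (sideVars side (pre ++ post))
occ-sideVars-focus side w pre e post =
  trans (occ-sideVars-middle side w pre (e ∷ []) post)
        (cong (_+ _) (trans (occ-++ w (vars (side e)) []) (+-identityʳ _)))

module _ (side : Eqn → Term) (side-applyE : ∀ σ E → map side (applyE σ E) ≡ applyL σ (map side E)) where

  sideVars-applyE : ∀ σ E → sideVars side (applyE σ E) ≡ concatMap (vars ∘ σ) (sideVars side E)
  sideVars-applyE σ E = trans (cong varsL (side-applyE σ E)) (varsL-applyL σ (map side E))

  occ-sideVars-substitute : ∀ {w x} t → w ≢ x → ∀ E →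
    occ w (sideVars side (applyE (single x t) E)) ≡ occ w (sideVars side E) + occ x (sideVars side E) * occ w (vars t)
  occ-sideVars-substitute t w≢x E =
    trans (cong (occ _) (sideVars-applyE (single _ t) E)) (occ-substitute t w≢x (sideVars side E))

  occ-sideVars-substitute-self : ∀ {x} t → ∀ E →
    occ x (sideVars side (applyE (single x t) E)) ≡ occ x (sideVars side E) * occ x (vars t)
  occ-sideVars-substitute-self t E =
    trans (cong (occ _) (sideVars-applyE (single _ t) E)) (occ-substitute-self t (sideVars side E))

lhs-applyE : ∀ σ E → map proj₁ (applyE σ E) ≡ applyL σ (map proj₁ E)
lhs-applyE σ []            = refl
lhs-applyE σ ((a , b) ∷ E) = cong (apply σ a ∷_) (lhs-applyE σ E)

rhs-applyE : ∀ σ E → map proj₂ (applyE σ E) ≡ applyL σ (map proj₂ E)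
rhs-applyE σ []            = refl
rhs-applyE σ ((a , b) ∷ E) = cong (apply σ b ∷_) (rhs-applyE σ E)

Reorientation : Eqn → Eqn → Set
Reorientation e e′ = e′ ≡ e ⊎ e′ ≡ flip e

Reoriented : List Eqn → List Eqn → Set
Reoriented = Pointwise Reorientation

WellOriented : List Eqn → Set
WellOriented F = ∀ w → occ w (lhsVars F) ≤ 1 × (occ w (lhsVars F) ≡ 0 ⊎ occ w (rhsVars F) ≡ 0)

Pointwise-++-∷⁻ : ∀ {R : Eqn → Eqn → Set} pre {e post F} → Pointwise R (pre ++ e ∷ post) F →
  ∃[ pre′ ] ∃[ e′ ] ∃[ post′ ] (F ≡ pre′ ++ e′ ∷ post′ × Pointwise R pre pre′ × R e e′ × Pointwise R post post′)
Pointwise-++-∷⁻ []        (e~ ∷ post~) = [] , _ , _ , refl , [] , e~ , post~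
Pointwise-++-∷⁻ (_ ∷ pre) (d~ ∷ rest~) with Pointwise-++-∷⁻ pre rest~
... | pre′ , e′ , post′ , refl , pre~ , e~ , post~ = _ ∷ pre′ , e′ , post′ , refl , d~ ∷ pre~ , e~ , post~

Reoriented-refl : ∀ E → Reoriented E E
Reoriented-refl []      = []
Reoriented-refl (e ∷ E) = inj₁ refl ∷ Reoriented-refl E

Reoriented-applyE : ∀ σ {E F} → Reoriented E F → Reoriented (applyE σ E) (applyE σ F)
Reoriented-applyE σ []                 = []
Reoriented-applyE σ (inj₁ refl ∷ E~F) = inj₁ refl ∷ Reoriented-applyE σ E~F
Reoriented-applyE σ (inj₂ refl ∷ E~F) = inj₂ refl ∷ Reoriented-applyE σ E~F

Reoriented-zip : ∀ ss ts → Reoriented (zip ss ts) (zip ts ss)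
Reoriented-zip []       []       = []
Reoriented-zip []       (_ ∷ _)  = []
Reoriented-zip (_ ∷ _)  []       = []
Reoriented-zip (s ∷ ss) (t ∷ ts) = inj₂ refl ∷ Reoriented-zip ss ts

∈-varsE⇒∈-sides : ∀ {x E F} → Reoriented E F → x ∈ varsE E → x ∈ lhsVars F ⊎ x ∈ rhsVars F
∈-varsE⇒∈-sides {E = (a , b) ∷ _} (inj₁ refl ∷ E~F) x∈ with ∈-++⁻ (vars a) x∈
... | inj₁ x∈a = inj₁ (∈-++⁺ˡ x∈a)
... | inj₂ x∈bE with ∈-++⁻ (vars b) x∈bE
...   | inj₁ x∈b = inj₂ (∈-++⁺ˡ x∈b)
...   | inj₂ x∈E = Sum.map (∈-++⁺ʳ (vars a)) (∈-++⁺ʳ (vars b)) (∈-varsE⇒∈-sides E~F x∈E)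
∈-varsE⇒∈-sides {E = (a , b) ∷ _} (inj₂ refl ∷ E~F) x∈ with ∈-++⁻ (vars a) x∈
... | inj₁ x∈a = inj₂ (∈-++⁺ˡ x∈a)
... | inj₂ x∈bE with ∈-++⁻ (vars b) x∈bE
...   | inj₁ x∈b = inj₁ (∈-++⁺ˡ x∈b)
...   | inj₂ x∈E = Sum.map (∈-++⁺ʳ (vars b)) (∈-++⁺ʳ (vars a)) (∈-varsE⇒∈-sides E~F x∈E)

sides-zip : ∀ (ss ts : List Term) → length ss ≡ length ts → map proj₁ (zip ss ts) ≡ ss × map proj₂ (zip ss ts) ≡ ts
sides-zip []       []       _   = refl , refl
sides-zip (s ∷ ss) (t ∷ ts) len with sides-zip ss ts (cong pred len)
... | l , r = cong (s ∷_) l , cong (t ∷_) r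

wellOriented-mono : ∀ {F F′} → WellOriented F →
  (∀ w → occ w (lhsVars F′) ≤ occ w (lhsVars F) × occ w (rhsVars F′) ≤ occ w (rhsVars F)) → WellOriented F′
wellOriented-mono wo le w with wo w | le w
... | l≤1 , inj₁ l≡0 | l′≤l , _    = ≤-trans l′≤l l≤1 , inj₁ (n≤0⇒n≡0 (subst (_ ≤_) l≡0 l′≤l))
... | l≤1 , inj₂ r≡0 | l′≤l , r′≤r = ≤-trans l′≤l l≤1 , inj₂ (n≤0⇒n≡0 (subst (_ ≤_) r≡0 r′≤r))

wellOriented-replace : ∀ pre e M post → WellOriented (pre ++ e ∷ post) →
  (∀ w → occ w (lhsVars M) ≤ occ w (vars (proj₁ e)) × occ w (rhsVars M) ≤ occ w (vars (proj₂ e))) →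
  WellOriented (pre ++ M ++ post)
wellOriented-replace pre e M post wo M≤e = wellOriented-mono {pre ++ e ∷ post} {pre ++ M ++ post} wo λ w →
  bound proj₁ w (proj₁ (M≤e w)) , bound proj₂ w (proj₂ (M≤e w))
  where
    bound : ∀ side w → occ w (sideVars side M) ≤ occ w (vars (side e)) →
            occ w (sideVars side (pre ++ M ++ post)) ≤ occ w (sideVars side (pre ++ e ∷ post))
    bound side w M≤e
      rewrite occ-sideVars-middle side w pre M post | occ-sideVars-focus side w pre e post = +-monoˡ-≤ _ M≤e

zip-sides-bound : ∀ ss ts → length ss ≡ length ts → ∀ w →
  occ w (lhsVars (zip ss ts)) ≤ occ w (varsL ss) × occ w (rhsVars (zip ss ts)) ≤ occ w (varsL ts)
zip-sides-bound ss ts len w with sides-zip ss ts len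
... | l , r = ≤-reflexive (cong (occ w ∘ varsL) l) , ≤-reflexive (cong (occ w ∘ varsL) r)

left-variable-isolated : ∀ pre′ post′ x t → WellOriented (pre′ ++ (var x , t) ∷ post′) →
  x ∉ lhsVars (pre′ ++ post′) × x ∉ rhsVars (pre′ ++ post′)
left-variable-isolated pre′ post′ x t wo with wo x
... | l≤1 , l≡0⊎r≡0
  rewrite occ-sideVars-focus proj₁ x pre′ (var x , t) post′
        | occ-sideVars-focus proj₂ x pre′ (var x , t) post′
        | occ-[ x ]
  = occ≡0⇒∉ (n≤0⇒n≡0 (≤-pred l≤1)) , occ≡0⇒∉ (rhs≡0 l≡0⊎r≡0)
  where rhs≡0 : (suc _ ≡ 0 ⊎ occ x (vars t) + occ x (rhsVars (pre′ ++ post′)) ≡ 0) → occ x (rhsVars (pre′ ++ post′)) ≡ 0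
        rhs≡0 (inj₂ r≡0) = m+n≡0⇒n≡0 (occ x (vars t)) r≡0

module Elimination (pre′ post′ : List Eqn) (x : ℕ) (t : Term) (x∉t : x ∉ vars t)
  (wo : WellOriented (pre′ ++ (t , var x) ∷ post′)) where

  private
    σ : Subst
    σ = single x t

    P : List Eqn
    P = pre′ ++ post′

    k : ℕ → ℕ
    k w = occ w (vars t)

    F-sides : ∀ side w → occ w (sideVars side (pre′ ++ (t , var x) ∷ post′))
                       ≡ occ w (vars (side (t , var x))) + occ w (sideVars side P)
    F-sides side w = occ-sideVars-focus side w pre′ (t , var x) post′

    x∉lhsP : occ x (lhsVars P) ≡ 0
    x∉lhsP with proj₂ (wo x)
    ... | inj₁ l≡0 = m+n≡0⇒n≡0 (k x) (trans (sym (F-sides proj₁ x)) l≡0)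
    ... | inj₂ r≡0 with trans (sym (F-sides proj₂ x)) r≡0
    ...   | 1+R≡0 rewrite occ-[ x ] = case 1+R≡0 of λ ()

    -- k counts w in t: a left-hand occurrence of w in t excludes all others on the left.
    absorb : ∀ k a r c → k + a ≤ 1 × (k + a ≡ 0 ⊎ r ≡ 0) → a ≤ 1 × (a ≡ 0 ⊎ k + (r + c * k) ≡ 0)
    absorb zero    a r c a-ok rewrite *-zeroʳ c | +-identityʳ r = a-ok
    absorb (suc k) a r c (k+a≤1 , _) = a≤1 , inj₁ (n≤0⇒n≡0 (m+n≤o⇒n≤o k (≤-pred k+a≤1)))
      where a≤1 = m+n≤o⇒n≤o (suc k) k+a≤1

    transport : ∀ {l r l′ r′} → l ≡ l′ → r ≡ r′ → l′ ≤ 1 × (l′ ≡ 0 ⊎ r′ ≡ 0) → l ≤ 1 × (l ≡ 0 ⊎ r ≡ 0)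
    transport refl refl p = p

  F₂ : List Eqn
  F₂ = applyE σ pre′ ++ (var x , t) ∷ applyE σ post′

  F₂-sides : ∀ side w → occ w (sideVars side F₂) ≡ occ w (vars (side (var x , t))) + occ w (sideVars side (applyE σ P))
  F₂-sides side w = trans (occ-sideVars-focus side w (applyE σ pre′) (var x , t) (applyE σ post′))
                          (cong (λ E → _ + occ w (sideVars side E)) (sym (applyE-++ σ pre′ post′)))

  lhs-self : occ x (lhsVars F₂) ≡ 1
  lhs-self = begin
    occ x (lhsVars F₂)                            ≡⟨ F₂-sides proj₁ x ⟩
    occ x (x ∷ []) + occ x (lhsVars (applyE σ P)) ≡⟨ cong₂ _+_ occ-[ x ] (occ-sideVars-substitute-self proj₁ lhs-applyE t P) ⟩
    1 + occ x (lhsVars P) * k x                   ≡⟨ cong (λ n → 1 + n * k x) x∉lhsP ⟩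
    1                                             ∎
    where open ≡-Reasoning

  rhs-self : occ x (rhsVars F₂) ≡ 0
  rhs-self = begin
    occ x (rhsVars F₂)                   ≡⟨ F₂-sides proj₂ x ⟩
    k x + occ x (rhsVars (applyE σ P))   ≡⟨ cong (k x +_) (occ-sideVars-substitute-self proj₂ rhs-applyE t P) ⟩
    k x + occ x (rhsVars P) * k x        ≡⟨ cong (λ n → n + occ x (rhsVars P) * n) (∉⇒occ≡0 (vars t) x∉t) ⟩
    occ x (rhsVars P) * 0                ≡⟨ *-zeroʳ (occ x (rhsVars P)) ⟩
    0                                    ∎
    where open ≡-Reasoning

  lhs-other : ∀ {w} → w ≢ x → occ w (lhsVars F₂) ≡ occ w (lhsVars P)
  lhs-other {w} w≢x = begin
    occ w (lhsVars F₂)                            ≡⟨ F₂-sides proj₁ w ⟩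
    occ w (x ∷ []) + occ w (lhsVars (applyE σ P)) ≡⟨ cong₂ _+_ (occ-[≢] w≢x) (occ-sideVars-substitute proj₁ lhs-applyE t w≢x P) ⟩
    occ w (lhsVars P) + occ x (lhsVars P) * k w   ≡⟨ cong (λ n → occ w (lhsVars P) + n * k w) x∉lhsP ⟩
    occ w (lhsVars P) + 0                         ≡⟨ +-identityʳ _ ⟩
    occ w (lhsVars P)                             ∎
    where open ≡-Reasoning

  rhs-other : ∀ {w} → w ≢ x → occ w (rhsVars F₂) ≡ k w + (occ w (rhsVars P) + occ x (rhsVars P) * k w)
  rhs-other {w} w≢x = trans (F₂-sides proj₂ w) (cong (k w +_) (occ-sideVars-substitute proj₂ rhs-applyE t w≢x P))

  wellOriented : WellOriented F₂
  wellOriented w with w ≟ x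
  ... | yes refl = transport lhs-self rhs-self (≤-refl , inj₂ refl)
  ... | no  w≢x  = transport (lhs-other w≢x) (rhs-other w≢x)
    (absorb (k w) (occ w (lhsVars P)) (occ w (rhsVars P)) (occ x (rhsVars P))
      (transport (sym (F-sides proj₁ w)) (sym (trans (F-sides proj₂ w) (cong (_+ _) (occ-[≢] w≢x)))) (wo w)))

MMAInvariant : List Eqn → Set
MMAInvariant E = ∃[ F ] (Reoriented E F × WellOriented F)

mmaStep-invariant : ∀ {E E′} → MMAStep E E′ → MMAInvariant E → MMAInvariant E′
mmaStep-invariant (decompose pre post f ss ts len) (F , E~F , wo) with Pointwise-++-∷⁻ pre E~F
... | pre′ , _ , post′ , refl , pre~ , inj₁ refl , post~ =
  pre′ ++ zip ss ts ++ post′ , ++⁺ pre~ (++⁺ (Reoriented-refl _) post~) ,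
  wellOriented-replace pre′ _ _ post′ wo (zip-sides-bound ss ts len)
... | pre′ , _ , post′ , refl , pre~ , inj₂ refl , post~ =
  pre′ ++ zip ts ss ++ post′ , ++⁺ pre~ (++⁺ (Reoriented-zip ss ts) post~) ,
  wellOriented-replace pre′ _ _ post′ wo (zip-sides-bound ts ss (sym len))
mmaStep-invariant (delete pre post x) (F , E~F , wo) with Pointwise-++-∷⁻ pre E~F
... | pre′ , _ , post′ , refl , pre~ , _ , post~ =
  pre′ ++ post′ , ++⁺ pre~ post~ , wellOriented-replace pre′ _ [] post′ wo (λ _ → z≤n , z≤n)
mmaStep-invariant (swap pre post t x _) (F , E~F , wo) with Pointwise-++-∷⁻ pre E~F
... | pre′ , _ , post′ , refl , pre~ , inj₁ refl , post~ = F , ++⁺ pre~ (inj₂ refl ∷ post~) , wo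
... | pre′ , _ , post′ , refl , pre~ , inj₂ refl , post~ = F , ++⁺ pre~ (inj₁ refl ∷ post~) , wo
mmaStep-invariant (eliminate pre post x t x∉t x∈E) (F , E~F , wo) with Pointwise-++-∷⁻ pre E~F
... | pre′ , _ , post′ , refl , pre~ , inj₁ refl , post~
  with left-variable-isolated pre′ post′ x t wo
...   | x∉lhs , x∉rhs = ⊥-elim (Sum.[ x∉lhs , x∉rhs ] (∈-varsE⇒∈-sides (++⁺ pre~ post~) x∈E))
mmaStep-invariant (eliminate pre post x t x∉t x∈E) (F , E~F , wo)
  | pre′ , _ , post′ , refl , pre~ , inj₂ refl , post~ =
  applyE (single x t) pre′ ++ (var x , t) ∷ applyE (single x t) post′ ,
  ++⁺ (Reoriented-applyE (single x t) pre~) (inj₁ refl ∷ Reoriented-applyE (single x t) post~) ,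
  Elimination.wellOriented pre′ post′ x t x∉t wo

mma-invariant : ∀ {E E′} → Star MMAStep E E′ → MMAInvariant E → MMAInvariant E′
mma-invariant ε        inv = inv
mma-invariant (s ◅ ss) inv = mma-invariant ss (mmaStep-invariant s inv)

action6⇒shared-var : ∀ {E F} → Reoriented E F → Action6Applicable E → ∃[ x ] (x ∈ lhsVars F × x ∈ rhsVars F)
action6⇒shared-var (inj₁ refl ∷ _) (here (x , t , refl , x∈t , _)) = x , here refl , ∈-++⁺ˡ x∈t
action6⇒shared-var (inj₂ refl ∷ _) (here (x , t , refl , x∈t , _)) = x , ∈-++⁺ˡ x∈t , here refl
action6⇒shared-var (_ ∷ E~F) (there a6) with action6⇒shared-var E~F a6
... | x , x∈l , x∈r = x , ∈-++⁺ʳ _ x∈l , ∈-++⁺ʳ _ x∈r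

mma-invariant⇒¬action6 : ∀ {E} → MMAInvariant E → ¬ Action6Applicable E
mma-invariant⇒¬action6 (F , E~F , wo) a6 with action6⇒shared-var E~F a6
... | x , x∈l , x∈r with proj₂ (wo x)
...   | inj₁ l≡0 = occ≡0⇒∉ l≡0 x∈l
...   | inj₂ r≡0 = occ≡0⇒∉ r≡0 x∈r

linear-disjoint⇒NSTO : ∀ A H → AtMostOnce (vars A) → (∀ {w} → w ∈ vars A → w ∉ vars H) → NSTO ((A , H) ∷ [])
linear-disjoint⇒NSTO A H A-lin A∩H≡∅ E′ run = mma-invariant⇒¬action6 (mma-invariant run (_ , Reoriented-refl _ , wo))
  where
    wo : WellOriented ((A , H) ∷ [])
    wo w rewrite occ-++ w (vars A) [] | occ-++ w (vars H) [] | +-identityʳ (occ w (vars A)) | +-identityʳ (occ w (vars H))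
      with occ≡0⊎occ>0 w (vars A)
    ... | inj₁ a≡0 = A-lin w , inj₁ a≡0
    ... | inj₂ a>0 = A-lin w , inj₂ (∉⇒occ≡0 (vars H) (A∩H≡∅ (occ>0⇒∈ (vars A) a>0)))

-- Most general unifiers of linear terms

Bindings : Set
Bindings = List (ℕ × Term)

dom rng : Bindings → List ℕ
dom = map proj₁
rng = concatMap (vars ∘ proj₂)

LinearBindings : Bindings → Set
LinearBindings bs = AtMostOnce (dom bs ++ rng bs)

substOf : Bindings → Subst
substOf []             x = var x
substOf ((v , r) ∷ bs) x with v ≟ x
... | yes _ = r
... | no  _ = substOf bs x

rng-∈ : ∀ {v r w} bs → (v , r) ∈ bs → w ∈ vars r → w ∈ rng bs
rng-∈ bs vr∈ w∈r = ∈-concatMap⁺ (vars ∘ proj₂) (Any.map (λ { refl → w∈r }) vr∈)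

substOf-∉ : ∀ {x} bs → x ∉ dom bs → substOf bs x ≡ var x
substOf-∉     []             _  = refl
substOf-∉ {x} ((v , r) ∷ bs) x∉ with v ≟ x
... | yes refl = ⊥-elim (x∉ (here refl))
... | no  _    = substOf-∉ bs (x∉ ∘ there)

substOf-∈ : ∀ {x r} bs → AtMostOnce (dom bs) → (x , r) ∈ bs → substOf bs x ≡ r
substOf-∈ {x} ((v , r′) ∷ bs) lin vr∈ with v ≟ x | vr∈
... | yes _    | here refl = refl
... | yes refl | there x∈  = ⊥-elim (AtMostOnce-++-disjoint (v ∷ []) lin (here refl) (∈-map⁺ proj₁ x∈))
... | no  v≢x  | here refl = ⊥-elim (v≢x refl)
... | no  _    | there x∈  = substOf-∈ bs (AtMostOnce-++ʳ (v ∷ []) lin) x∈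

substOf-view : ∀ x bs → (x ∉ dom bs × substOf bs x ≡ var x) ⊎ ∃[ r ] ((x , r) ∈ bs)
substOf-view x bs with x ∈? dom bs
... | no  x∉ = inj₁ (x∉ , substOf-∉ bs x∉)
... | yes x∈ with ∈-map⁻ proj₁ x∈
...   | (_ , r) , vr∈ , refl = inj₂ (r , vr∈)

rng-fixed : ∀ {v r w} bs → LinearBindings bs → (v , r) ∈ bs → w ∈ vars r → substOf bs w ≡ var w
rng-fixed bs lin vr∈ w∈r = substOf-∉ bs λ w∈dom → AtMostOnce-++-disjoint (dom bs) lin w∈dom (rng-∈ bs vr∈ w∈r)

substOf-instance : ∀ σ bs → (∀ {v r} → (v , r) ∈ bs → σ v ≡ apply σ r) → ∀ x → σ x ≡ apply σ (substOf bs x)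
substOf-instance σ []             _      x = refl
substOf-instance σ ((v , r) ∷ bs) σ⊨bs x with v ≟ x
... | yes refl = σ⊨bs (here refl)
... | no  _    = substOf-instance σ bs (σ⊨bs ∘ there) x

rng-occ : ∀ {v r} w bs → (v , r) ∈ bs → occ w (vars r) ≤ occ w (rng bs)
rng-occ w ((v , r) ∷ bs) (here refl) = ≤-trans (m≤m+n _ _) (≤-reflexive (sym (occ-++ w (vars r) (rng bs))))
rng-occ w ((v , r) ∷ bs) (there vr∈) =
  ≤-trans (rng-occ w bs vr∈) (≤-trans (m≤n+m _ _) (≤-reflexive (sym (occ-++ w (vars r) (rng bs)))))

rng-occ₂ : ∀ {v₁ r₁ v₂ r₂} w bs → (v₁ , r₁) ∈ bs → (v₂ , r₂) ∈ bs → v₁ ≢ v₂ →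
  occ w (vars r₁) + occ w (vars r₂) ≤ occ w (rng bs)
rng-occ₂ w ((v , r) ∷ bs) (here refl)  (here refl)  v≢v = ⊥-elim (v≢v refl)
rng-occ₂ w ((v , r) ∷ bs) (here refl)  (there vr∈₂) _ =
  ≤-trans (+-monoʳ-≤ (occ w (vars r)) (rng-occ w bs vr∈₂)) (≤-reflexive (sym (occ-++ w (vars r) (rng bs))))
rng-occ₂ w ((v , r) ∷ bs) (there vr∈₁) (here refl)  _ =
  ≤-trans (≤-reflexive (+-comm _ (occ w (vars r))))
    (≤-trans (+-monoʳ-≤ (occ w (vars r)) (rng-occ w bs vr∈₁)) (≤-reflexive (sym (occ-++ w (vars r) (rng bs)))))
rng-occ₂ w ((v , r) ∷ bs) (there vr∈₁) (there vr∈₂) v₁≢v₂ =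
  ≤-trans (rng-occ₂ w bs vr∈₁ vr∈₂ v₁≢v₂) (≤-trans (m≤n+m _ _) (≤-reflexive (sym (occ-++ w (vars r) (rng bs)))))

SafeFor : (ℕ → Set) → Bindings → Set
SafeFor X bs = ∀ {v r w} → (v , r) ∈ bs → ¬ X v → w ∈ vars r → X w

module _ (X : ℕ → Set) (bs : Bindings) (lin : LinearBindings bs) (safe : SafeFor X bs) where

  private
    dom-lin : AtMostOnce (dom bs)
    dom-lin = AtMostOnce-++ˡ (dom bs) lin

    rng-lin : AtMostOnce (rng bs)
    rng-lin = AtMostOnce-++ʳ (dom bs) lin

    image-lin : ∀ v → AtMostOnce (vars (substOf bs v))
    image-lin v w with substOf-view v bs
    ... | inj₁ (_ , ≡var) rewrite ≡var = AtMostOnce-[ v ] w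
    ... | inj₂ (r , vr∈) rewrite substOf-∈ bs dom-lin vr∈ = ≤-trans (rng-occ w bs vr∈) (rng-lin w)

    ∈-image : ∀ {v w} → w ∈ vars (substOf bs v) → w ≡ v ⊎ ∃[ r ] ((v , r) ∈ bs × w ∈ vars r)
    ∈-image {v} w∈ with substOf-view v bs
    ... | inj₁ (_ , ≡var) with subst (λ t → _ ∈ vars t) ≡var w∈
    ...   | here w≡v = inj₁ w≡v
    ∈-image {v} w∈ | inj₂ (r , vr∈) = inj₂ (r , vr∈ , subst (λ t → _ ∈ vars t) (substOf-∈ bs dom-lin vr∈) w∈)

  substOf-AtMostOnce : ∀ t → AtMostOnce (vars t) → (∀ {v} → v ∈ vars t → ¬ X v) →
    AtMostOnce (vars (apply (substOf bs) t))
  substOf-AtMostOnce t t-lin t∩X≡∅ = subst AtMostOnce (sym (vars-apply (substOf bs) t))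
    (concatMap-AtMostOnce (vars ∘ substOf bs) (vars t) t-lin (λ {v} _ → image-lin v) disjoint)
    where
      disjoint : ∀ {v₁ v₂ w} → v₁ ∈ vars t → v₂ ∈ vars t → v₁ ≢ v₂ →
                 w ∈ vars (substOf bs v₁) → w ∉ vars (substOf bs v₂)
      disjoint {w = w} v₁∈ v₂∈ v₁≢v₂ w∈₁ w∈₂ with ∈-image w∈₁ | ∈-image w∈₂
      ... | inj₁ refl | inj₁ refl = v₁≢v₂ refl
      ... | inj₁ refl | inj₂ (_ , vr₂∈ , w∈r₂) = t∩X≡∅ v₁∈ (safe vr₂∈ (t∩X≡∅ v₂∈) w∈r₂)
      ... | inj₂ (_ , vr₁∈ , w∈r₁) | inj₁ refl = t∩X≡∅ v₂∈ (safe vr₁∈ (t∩X≡∅ v₁∈) w∈r₁)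
      ... | inj₂ (r₁ , vr₁∈ , w∈r₁) | inj₂ (r₂ , vr₂∈ , w∈r₂) = 2≰1 (begin
        2                                       ≤⟨ +-mono-≤ (∈⇒occ>0 w∈r₁) (∈⇒occ>0 w∈r₂) ⟩
        occ w (vars r₁) + occ w (vars r₂)       ≤⟨ rng-occ₂ w bs vr₁∈ vr₂∈ v₁≢v₂ ⟩
        occ w (rng bs)                          ≤⟨ rng-lin w ⟩
        1                                       ∎)
        where open ≤-Reasoning

occ-dom-++ : ∀ w bs cs → occ w (dom (bs ++ cs)) ≡ occ w (dom bs) + occ w (dom cs)
occ-dom-++ w bs cs = trans (cong (occ w) (map-++ proj₁ bs cs)) (occ-++ w (dom bs) (dom cs))

occ-rng-++ : ∀ w bs cs → occ w (rng (bs ++ cs)) ≡ occ w (rng bs) + occ w (rng cs)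
occ-rng-++ w bs cs = trans (cong (occ w) (concatMap-++ (vars ∘ proj₂) bs cs)) (occ-++ w (rng bs) (rng cs))

occ-rng-single : ∀ v r w → occ w (rng ((v , r) ∷ [])) ≡ occ w (vars r)
occ-rng-single v r w = trans (occ-++ w (vars r) []) (+-identityʳ _)

mutual
  pairBindings : Term → Term → Bindings
  pairBindings (var x)   t         = (x , t) ∷ []
  pairBindings (fn f ss) (var y)   = (y , fn f ss) ∷ []
  pairBindings (fn f ss) (fn g ts) = pairBindingsL ss ts

  pairBindingsL : List Term → List Term → Bindings
  pairBindingsL (s ∷ ss) (t ∷ ts) = pairBindings s t ++ pairBindingsL ss ts
  pairBindingsL _        _        = []

mutual
  pairBindings-occ : ∀ w a h →
    occ w (dom (pairBindings a h)) + occ w (rng (pairBindings a h)) ≤ occ w (vars a) + occ w (vars h)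
  pairBindings-occ w (var x)   t         = ≤-reflexive (cong (occ w (x ∷ []) +_) (occ-rng-single x t w))
  pairBindings-occ w (fn f ss) (var y)   =
    ≤-reflexive (trans (cong (occ w (y ∷ []) +_) (occ-rng-single y (fn f ss) w)) (+-comm (occ w (y ∷ [])) _))
  pairBindings-occ w (fn f ss) (fn g ts) = pairBindingsL-occ w ss ts

  pairBindingsL-occ : ∀ w ss ts →
    occ w (dom (pairBindingsL ss ts)) + occ w (rng (pairBindingsL ss ts)) ≤ occ w (varsL ss) + occ w (varsL ts)
  pairBindingsL-occ w (s ∷ ss) (t ∷ ts) = begin
    occ w (dom (bs ++ cs)) + occ w (rng (bs ++ cs))
      ≡⟨ cong₂ _+_ (occ-dom-++ w bs cs) (occ-rng-++ w bs cs) ⟩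
    (occ w (dom bs) + occ w (dom cs)) + (occ w (rng bs) + occ w (rng cs))
      ≡⟨ interchange (occ w (dom bs)) _ _ _ ⟩
    (occ w (dom bs) + occ w (rng bs)) + (occ w (dom cs) + occ w (rng cs))
      ≤⟨ +-mono-≤ (pairBindings-occ w s t) (pairBindingsL-occ w ss ts) ⟩
    (occ w (vars s) + occ w (vars t)) + (occ w (varsL ss) + occ w (varsL ts))
      ≡⟨ interchange (occ w (vars s)) _ _ _ ⟩
    (occ w (vars s) + occ w (varsL ss)) + (occ w (vars t) + occ w (varsL ts))
      ≡⟨ cong₂ _+_ (occ-++ w (vars s) (varsL ss)) (occ-++ w (vars t) (varsL ts)) ⟨
    occ w (varsL (s ∷ ss)) + occ w (varsL (t ∷ ts)) ∎
    where
      open ≤-Reasoning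
      bs = pairBindings s t
      cs = pairBindingsL ss ts
      interchange : ∀ a b c d → (a + b) + (c + d) ≡ (a + c) + (b + d)
      interchange = solve 4 (λ a b c d → (a :+ b) :+ (c :+ d) := (a :+ c) :+ (b :+ d)) refl
        where open +-*-Solver
  pairBindingsL-occ w []       _        = z≤n
  pairBindingsL-occ w (_ ∷ _)  []       = z≤n

mutual
  pairBindings-∈ : ∀ {v r} a h → (v , r) ∈ pairBindings a h →
    (v ∈ vars a × vars r ⊆ vars h) ⊎ (v ∈ vars h × vars r ⊆ vars a)
  pairBindings-∈ (var x)   t         (here refl) = inj₁ (here refl , λ w∈ → w∈)
  pairBindings-∈ (fn f ss) (var y)   (here refl) = inj₂ (here refl , λ w∈ → w∈)
  pairBindings-∈ (fn f ss) (fn g ts) vr∈         = pairBindingsL-∈ ss ts vr∈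

  pairBindingsL-∈ : ∀ {v r} ss ts → (v , r) ∈ pairBindingsL ss ts →
    (v ∈ varsL ss × vars r ⊆ varsL ts) ⊎ (v ∈ varsL ts × vars r ⊆ varsL ss)
  pairBindingsL-∈ (s ∷ ss) (t ∷ ts) vr∈ with ∈-++⁻ (pairBindings s t) vr∈
  ... | inj₁ vr∈st = Sum.map (Product.map ∈-++⁺ˡ (λ r⊆ w∈ → ∈-++⁺ˡ (r⊆ w∈)))
                             (Product.map ∈-++⁺ˡ (λ r⊆ w∈ → ∈-++⁺ˡ (r⊆ w∈))) (pairBindings-∈ s t vr∈st)
  ... | inj₂ vr∈ss = Sum.map (Product.map (∈-++⁺ʳ (vars s)) (λ r⊆ w∈ → ∈-++⁺ʳ (vars t) (r⊆ w∈)))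
                             (Product.map (∈-++⁺ʳ (vars t)) (λ r⊆ w∈ → ∈-++⁺ʳ (vars s) (r⊆ w∈))) (pairBindingsL-∈ ss ts vr∈ss)

mutual
  pairBindings-sound : ∀ σ a h → Unifier σ a h → ∀ {v r} → (v , r) ∈ pairBindings a h → σ v ≡ apply σ r
  pairBindings-sound σ (var x)   t         σa≡σh (here refl) = σa≡σh
  pairBindings-sound σ (fn f ss) (var y)   σa≡σh (here refl) = sym σa≡σh
  pairBindings-sound σ (fn f ss) (fn g ts) σa≡σh vr∈ = pairBindingsL-sound σ ss ts (proj₂ (fn-injective σa≡σh)) vr∈

  pairBindingsL-sound : ∀ σ ss ts → applyL σ ss ≡ applyL σ ts → ∀ {v r} → (v , r) ∈ pairBindingsL ss ts → σ v ≡ apply σ r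
  pairBindingsL-sound σ (s ∷ ss) (t ∷ ts) eq vr∈ with ∈-++⁻ (pairBindings s t) vr∈
  ... | inj₁ vr∈st = pairBindings-sound σ s t (∷-injectiveˡ eq) vr∈st
  ... | inj₂ vr∈ss = pairBindingsL-sound σ ss ts (∷-injectiveʳ eq) vr∈ss

Realises : Subst → Bindings → Set
Realises θ bs = ∀ {v r} → (v , r) ∈ bs → θ v ≡ r × (∀ w → w ∈ vars r → θ w ≡ var w)

mutual
  pairBindings-complete : ∀ τ θ a h → Unifier τ a h → Realises θ (pairBindings a h) → Unifier θ a h
  pairBindings-complete τ θ (var x)   t         _   θ⊨ with θ⊨ (here refl)
  ... | θx≡t , θ-fixes = trans θx≡t (sym (apply-fixes θ t θ-fixes))
  pairBindings-complete τ θ (fn f ss) (var y)   _   θ⊨ with θ⊨ (here refl)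
  ... | θy≡a , θ-fixes = sym (trans θy≡a (sym (apply-fixes θ (fn f ss) θ-fixes)))
  pairBindings-complete τ θ (fn f ss) (fn g ts) τ⊨ θ⊨ with fn-injective τ⊨
  ... | refl , τss≡τts = cong (fn f) (pairBindingsL-complete τ θ ss ts τss≡τts θ⊨)

  pairBindingsL-complete : ∀ τ θ ss ts → applyL τ ss ≡ applyL τ ts → Realises θ (pairBindingsL ss ts) →
    applyL θ ss ≡ applyL θ ts
  pairBindingsL-complete τ θ []       []       _  _  = refl
  pairBindingsL-complete τ θ (s ∷ ss) (t ∷ ts) eq θ⊨ =
    cong₂ _∷_ (pairBindings-complete τ θ s t (∷-injectiveˡ eq) (θ⊨ ∘ ∈-++⁺ˡ))
              (pairBindingsL-complete τ θ ss ts (∷-injectiveʳ eq) (θ⊨ ∘ ∈-++⁺ʳ (pairBindings s t)))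

rng-ground : ∀ bs → (∀ {v r} → (v , r) ∈ bs → Ground r) → rng bs ≡ []
rng-ground []             _      = refl
rng-ground ((v , r) ∷ bs) ground = trans (cong (_++ rng bs) (ground (here refl))) (rng-ground bs (ground ∘ there))

-- head′ is H with its pinned variables, which every unifier with A sends to the same ground
-- terms, already replaced by those terms.
record LinearisedHead (A H : Term) (clauseVars : List ℕ) : Set where
  field
    pinned        : Bindings
    pinned-ground : ∀ {v r} → (v , r) ∈ pinned → Ground r
    pinned-forced : ∀ σ → Unifier σ A H → ∀ {v r} → (v , r) ∈ pinned → σ v ≡ r
    head′         : Term
    head′-agrees  : ∀ σ → (∀ {v r} → (v , r) ∈ pinned → σ v ≡ r) → apply σ H ≡ apply σ head′
    head′-linear  : AtMostOnce (dom pinned ++ vars head′)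
    pinned⊆       : dom pinned ⊆ clauseVars
    head′⊆        : vars head′ ⊆ clauseVars

module MGULinearity {A H : Term} {θ : Subst} {clauseVars : List ℕ} (mgu : MGU θ A H)
  (A-linear : AtMostOnce (vars A)) (apart : ∀ {w} → w ∈ clauseVars → w ∉ vars A)
  (L : LinearisedHead A H clauseVars) where

  open LinearisedHead L

  bs : Bindings
  bs = pinned ++ pairBindings A head′

  θ₀ : Subst
  θ₀ = substOf bs

  bs-occ : ∀ w → occ w (dom bs ++ rng bs) ≤ occ w (dom pinned) + (occ w (vars A) + occ w (vars head′))
  bs-occ w = begin
    occ w (dom bs ++ rng bs)
      ≡⟨ occ-++ w (dom bs) (rng bs) ⟩
    occ w (dom bs) + occ w (rng bs)
      ≡⟨ cong₂ _+_ (occ-dom-++ w pinned pairs) (occ-rng-++ w pinned pairs) ⟩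
    (occ w (dom pinned) + occ w (dom pairs)) + (occ w (rng pinned) + occ w (rng pairs))
      ≡⟨ cong (λ vs → (occ w (dom pinned) + occ w (dom pairs)) + (occ w vs + occ w (rng pairs)))
              (rng-ground pinned pinned-ground) ⟩
    (occ w (dom pinned) + occ w (dom pairs)) + occ w (rng pairs)
      ≡⟨ +-assoc (occ w (dom pinned)) _ _ ⟩
    occ w (dom pinned) + (occ w (dom pairs) + occ w (rng pairs))
      ≤⟨ +-monoʳ-≤ (occ w (dom pinned)) (pairBindings-occ w A head′) ⟩
    occ w (dom pinned) + (occ w (vars A) + occ w (vars head′)) ∎
    where open ≤-Reasoning
          pairs = pairBindings A head′

  bs-linear : LinearBindings bs
  bs-linear w with occ≡0⊎occ>0 w (vars A)
  ... | inj₁ w∉A = ≤-trans (bs-occ w) (begin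
    occ w (dom pinned) + (occ w (vars A) + occ w (vars head′)) ≡⟨ cong (λ n → occ w (dom pinned) + (n + _)) w∉A ⟩
    occ w (dom pinned) + occ w (vars head′)                    ≡⟨ occ-++ w (dom pinned) (vars head′) ⟨
    occ w (dom pinned ++ vars head′)                           ≤⟨ head′-linear w ⟩
    1                                                          ∎)
    where open ≤-Reasoning
  ... | inj₂ w∈A = ≤-trans (bs-occ w) (begin
    occ w (dom pinned) + (occ w (vars A) + occ w (vars head′)) ≡⟨ cong₂ (λ m n → m + (_ + n)) (∉⇒occ≡0 _ (outside ∘ pinned⊆))
                                                                                          (∉⇒occ≡0 _ (outside ∘ head′⊆)) ⟩
    occ w (vars A) + 0                                         ≡⟨ +-identityʳ _ ⟩
    occ w (vars A)                                             ≤⟨ A-linear w ⟩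
    1                                                          ∎)
    where open ≤-Reasoning
          outside : w ∉ clauseVars
          outside w∈ = apart w∈ (occ>0⇒∈ (vars A) w∈A)

  private
    dom-linear : AtMostOnce (dom bs)
    dom-linear = AtMostOnce-++ˡ (dom bs) bs-linear

  θ₀-realises : Realises θ₀ bs
  θ₀-realises vr∈ = substOf-∈ bs dom-linear vr∈ , λ w → rng-fixed bs bs-linear vr∈

  instance-of-θ₀ : ∀ σ → Unifier σ A H → ∀ x → σ x ≡ apply σ (θ₀ x)
  instance-of-θ₀ σ σ-unifies = substOf-instance σ bs λ {v} {r} vr∈ → case ∈-++⁻ pinned vr∈ of λ where
    (inj₁ vr∈pinned) → trans (pinned-forced σ σ-unifies vr∈pinned) (sym (apply-ground σ r (pinned-ground vr∈pinned)))
    (inj₂ vr∈pairs)  → pairBindings-sound σ A head′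
                         (trans σ-unifies (head′-agrees σ (pinned-forced σ σ-unifies))) vr∈pairs

  θ₀-unifies : Unifier θ₀ A H
  θ₀-unifies = trans
    (pairBindings-complete θ θ₀ A head′ (trans (proj₁ mgu) (head′-agrees θ (pinned-forced θ (proj₁ mgu))))
                           (θ₀-realises ∘ ∈-++⁺ʳ pinned))
    (sym (head′-agrees θ₀ (proj₁ ∘ θ₀-realises ∘ ∈-++⁺ˡ)))

  -- θ agrees with θ ∘ θ₀ and θ₀ = η ∘ θ, so η is a left inverse of θ on the image of θ₀.
  θ₀-linear⇒θ-linear : ∀ t → AtMostOnce (vars (apply θ₀ t)) → AtMostOnce (vars (apply θ t))
  θ₀-linear⇒θ-linear t lin₀ = subst (AtMostOnce ∘ vars) (sym θt≡θθ₀t) (renaming-AtMostOnce η θ (apply θ₀ t) inverse lin₀)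
    where
      η = proj₁ (proj₂ mgu θ₀ θ₀-unifies)
      θ₀≡ηθ = proj₂ (proj₂ mgu θ₀ θ₀-unifies)
      θt≡θθ₀t : apply θ t ≡ apply θ (apply θ₀ t)
      θt≡θθ₀t = trans (apply-cong t (λ x _ → instance-of-θ₀ θ (proj₁ mgu) x)) (sym (apply-∘ θ θ₀ t))
      inverse : apply η (apply θ (apply θ₀ t)) ≡ apply θ₀ t
      inverse = begin
        apply η (apply θ (apply θ₀ t)) ≡⟨ cong (apply η) θt≡θθ₀t ⟨
        apply η (apply θ t)            ≡⟨ apply-∘ η θ t ⟩
        apply (apply η ∘ θ) t          ≡⟨ apply-cong t (λ x _ → θ₀≡ηθ x) ⟨
        apply θ₀ t                     ∎
        where open ≡-Reasoning

  mgu-linear-outside : ∀ B → AtMostOnce (vars B) → (∀ {w} → w ∈ vars B → w ∉ clauseVars) → AtMostOnce (vars (apply θ B))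
  mgu-linear-outside B B-linear B-apart = θ₀-linear⇒θ-linear B
    (substOf-AtMostOnce (_∈ clauseVars) bs bs-linear safe B B-linear B-apart)
    where
      safe : SafeFor (_∈ clauseVars) bs
      safe {r = r} vr∈ v∉ w∈r with ∈-++⁻ pinned vr∈
      ... | inj₁ vr∈pinned = ⊥-elim (∉-ground r (pinned-ground vr∈pinned) w∈r)
      ... | inj₂ vr∈pairs with pairBindings-∈ A head′ vr∈pairs
      ...   | inj₁ (_ , r⊆head′) = head′⊆ (r⊆head′ w∈r)
      ...   | inj₂ (v∈head′ , _) = ⊥-elim (v∉ (head′⊆ v∈head′))

  mgu-linear-inside : ∀ b → AtMostOnce (vars b) → vars b ⊆ clauseVars → AtMostOnce (vars (apply θ b))
  mgu-linear-inside b b-linear b⊆ = θ₀-linear⇒θ-linear b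
    (substOf-AtMostOnce (_∈ vars A) bs bs-linear safe b b-linear (apart ∘ b⊆))
    where
      safe : SafeFor (_∈ vars A) bs
      safe {r = r} vr∈ v∉ w∈r with ∈-++⁻ pinned vr∈
      ... | inj₁ vr∈pinned = ⊥-elim (∉-ground r (pinned-ground vr∈pinned) w∈r)
      ... | inj₂ vr∈pairs with pairBindings-∈ A head′ vr∈pairs
      ...   | inj₁ (v∈A , _)   = ⊥-elim (v∉ v∈A)
      ...   | inj₂ (_ , r⊆A) = r⊆A w∈r

linearHead : ∀ {A H clauseVars} → AtMostOnce (vars H) → vars H ⊆ clauseVars → LinearisedHead A H clauseVars
linearHead {H = H} H-linear H⊆ = record
  { pinned        = []
  ; pinned-ground = λ ()
  ; pinned-forced = λ _ _ ()
  ; head′         = H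
  ; head′-agrees  = λ _ _ → refl
  ; head′-linear  = H-linear
  ; pinned⊆       = λ ()
  ; head′⊆        = H⊆
  }

-- Ground input arguments

GroundInput : Term → Set
GroundInput (fn _ (i ∷ _)) = Ground i
GroundInput _              = ⊥

GroundInput-apply : ∀ σ t → GroundInput t → GroundInput (apply σ t)
GroundInput-apply σ (fn p (i ∷ ts)) i-ground = trans (cong vars (apply-ground σ i i-ground)) i-ground

LinearGroundInput : Term → Set
LinearGroundInput t = AtMostOnce (vars t) × GroundInput t

inputVars : Term → List ℕ
inputVars (fn _ (i ∷ _)) = vars i
inputVars _              = []

inputVars⊆vars : ∀ t → inputVars t ⊆ vars t
inputVars⊆vars (fn _ (i ∷ _)) = ∈-++⁺ˡ

module _ {σ τ : Subst} where

  input-agree : ∀ A H → GroundInput A → Unifier σ A H → Unifier τ A H → ∀ {x} → x ∈ inputVars H → σ x ≡ τ x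
  input-agree (fn _ (g ∷ _)) (fn _ (h₀ ∷ _)) g-ground σ-unifies τ-unifies = apply-agree-on-vars h₀ (begin
    apply σ h₀ ≡⟨ ∷-injectiveˡ (proj₂ (fn-injective σ-unifies)) ⟨
    apply σ g  ≡⟨ apply-ground σ g g-ground ⟩
    g          ≡⟨ apply-ground τ g g-ground ⟨
    apply τ g  ≡⟨ ∷-injectiveˡ (proj₂ (fn-injective τ-unifies)) ⟩
    apply τ h₀ ∎)
    where open ≡-Reasoning

input-grounded : ∀ {θ} A H → GroundInput A → Unifier θ A H → ∀ {x} → x ∈ inputVars H → Ground (θ x)
input-grounded {θ} (fn _ (g ∷ _)) (fn _ (h₀ ∷ _)) g-ground θ-unifies x∈h₀ = ⊆[]⇒≡[] λ w∈ →
  subst (_ ∈_) (trans (cong vars θh₀≡g) g-ground) (vars-image-⊆ θ h₀ x∈h₀ w∈)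
  where θh₀≡g : apply θ h₀ ≡ g
        θh₀≡g = trans (sym (∷-injectiveˡ (proj₂ (fn-injective θ-unifies)))) (apply-ground θ g g-ground)

module Pinning {θ : Subst} {x : ℕ} (A H : Term) (A-input : GroundInput A) (θ-unifies : Unifier θ A H)
  (x∈input : x ∈ inputVars H) where

  pinned-ground : Ground (θ x)
  pinned-ground = input-grounded A H A-input θ-unifies x∈input

  private
    σ₀ : Subst
    σ₀ = single x (θ x)

    occ-θx : ∀ w → occ w (vars (θ x)) ≡ 0
    occ-θx w = ∉⇒occ≡0 _ (∉-ground (θ x) pinned-ground)

    occ-pinned-self : occ x (vars (apply σ₀ H)) ≡ 0
    occ-pinned-self = begin
      occ x (vars (apply σ₀ H))              ≡⟨ cong (occ x) (vars-apply σ₀ H) ⟩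
      occ x (concatMap (vars ∘ σ₀) (vars H)) ≡⟨ occ-substitute-self (θ x) (vars H) ⟩
      occ x (vars H) * occ x (vars (θ x))    ≡⟨ cong (occ x (vars H) *_) (occ-θx x) ⟩
      occ x (vars H) * 0                     ≡⟨ *-zeroʳ (occ x (vars H)) ⟩
      0                                      ∎
      where open ≡-Reasoning

    occ-pinned-other : ∀ {w} → w ≢ x → occ w (vars (apply σ₀ H)) ≡ occ w (vars H)
    occ-pinned-other {w} w≢x = begin
      occ w (vars (apply σ₀ H))                          ≡⟨ cong (occ w) (vars-apply σ₀ H) ⟩
      occ w (concatMap (vars ∘ σ₀) (vars H))             ≡⟨ occ-substitute (θ x) w≢x (vars H) ⟩
      occ w (vars H) + occ x (vars H) * occ w (vars (θ x)) ≡⟨ cong (λ n → occ w (vars H) + occ x (vars H) * n) (occ-θx w) ⟩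
      occ w (vars H) + occ x (vars H) * 0                ≡⟨ cong (occ w (vars H) +_) (*-zeroʳ (occ x (vars H))) ⟩
      occ w (vars H) + 0                                 ≡⟨ +-identityʳ _ ⟩
      occ w (vars H)                                     ∎
      where open ≡-Reasoning

  pinnedHead : ∀ {clauseVars} → AtMostOnceExcept x (vars H) → vars H ⊆ clauseVars → LinearisedHead A H clauseVars
  pinnedHead {clauseVars} H-linear H⊆ = record
    { pinned        = (x , θ x) ∷ []
    ; pinned-ground = λ { (here refl) → pinned-ground }
    ; pinned-forced = λ { σ σ-unifies (here refl) → input-agree A H A-input σ-unifies θ-unifies x∈input }
    ; head′         = apply σ₀ H
    ; head′-agrees  = agrees
    ; head′-linear  = linear
    ; pinned⊆       = λ { (here refl) → H⊆ (inputVars⊆vars H x∈input) }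
    ; head′⊆        = ⊆clause
    }
    where
      agrees : ∀ σ → (∀ {v r} → (v , r) ∈ (x , θ x) ∷ [] → σ v ≡ r) → apply σ H ≡ apply σ (apply σ₀ H)
      agrees σ σ⊨ = trans (apply-cong H agree-on) (sym (apply-∘ σ σ₀ H))
        where
          agree-on : ∀ y → y ∈ vars H → σ y ≡ apply σ (σ₀ y)
          agree-on y _ with x ≟ y
          ... | yes refl = trans (σ⊨ (here refl)) (sym (apply-ground σ (θ x) pinned-ground))
          ... | no  _    = refl

      linear : AtMostOnce (x ∷ vars (apply σ₀ H))
      linear w with w ≟ x
      ... | yes refl rewrite occ-pinned-self = s≤s z≤n
      ... | no  w≢x  rewrite occ-pinned-other w≢x = H-linear w w≢x

      ⊆clause : vars (apply σ₀ H) ⊆ clauseVars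
      ⊆clause {w} w∈ with w ≟ x
      ... | yes refl = ⊥-elim (occ≡0⇒∉ occ-pinned-self w∈)
      ... | no  w≢x  = H⊆ (occ>0⇒∈ (vars H) (subst (0 <_) (occ-pinned-other w≢x) (∈⇒occ>0 w∈)))

-- The program NQUEENS

renamed-AtMostOnce : ∀ {ρ : ℕ → ℕ} → Injective _≡_ _≡_ ρ → ∀ t → Unique (vars t) → AtMostOnce (vars (apply (var ∘ ρ) t))
renamed-AtMostOnce {ρ} ρ-inj t unique = subst AtMostOnce (sym (vars-rename ρ t)) (Unique⇒AtMostOnce (Unique.map⁺ ρ-inj unique))

renamed-AtMostOnceExcept : ∀ {ρ : ℕ → ℕ} → Injective _≡_ _≡_ ρ → ∀ x t →
  {True (unique? (filter (λ v → ¬? (v ≟ x)) (vars t)))} → AtMostOnceExcept (ρ x) (vars (apply (var ∘ ρ) t))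
renamed-AtMostOnceExcept {ρ} ρ-inj x t {unique} = subst (AtMostOnceExcept (ρ x)) (sym (vars-rename ρ t))
  (AtMostOnceExcept-map ρ-inj {xs = vars t} (AtMostOnceExcept-filter x (vars t) (Unique⇒AtMostOnce (toWitness unique))))

renamed-body-AtMostOnce : ∀ {ρ : ℕ → ℕ} → Injective _≡_ _≡_ ρ → ∀ bs → {True (All.all? (unique? ∘ vars) bs)} →
  ∀ {b} → b ∈ applyL (var ∘ ρ) bs → AtMostOnce (vars b)
renamed-body-AtMostOnce ρ-inj bs {all-unique} = go bs (toWitness all-unique)
  where
    go : ∀ bs → All (Unique ∘ vars) bs → ∀ {b} → b ∈ applyL (var ∘ _) bs → AtMostOnce (vars b)
    go (b ∷ bs) (unique ∷ _)     (here refl) = renamed-AtMostOnce ρ-inj b unique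
    go (b ∷ bs) (_ ∷ all-unique) (there b∈)  = go bs all-unique b∈

record ResolutionData (A : Term) (θ : Subst) (ρ : ℕ → ℕ) (c : Clause) : Set where
  field
    linearised   : LinearisedHead A (head (rename ρ c)) (varsC (rename ρ c))
    body-linear  : ∀ {b} → b ∈ body (rename ρ c) → AtMostOnce (vars b)
    body-grounds : ∀ {b} → b ∈ body (rename ρ c) → GroundInput (apply θ b)

nqueens-resolution : ∀ {c A θ ρ} → c ∈ nqueens → Injective _≡_ _≡_ ρ → GroundInput A →
  Unifier θ A (head (rename ρ c)) → ResolutionData A θ ρ c
nqueens-resolution {A = var _}          _ _ () _
nqueens-resolution {A = fn _ []}        _ _ () _
nqueens-resolution {c} {A = A@(fn _ (_ ∷ _))} {ρ = ρ} (here refl) ρ-inj _ _ = record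
  { linearised   = linearHead (renamed-AtMostOnce ρ-inj (head c) (from-yes (unique? (vars (head c)))))
                              (headVars⊆ (rename ρ c))
  ; body-linear  = λ ()
  ; body-grounds = λ ()
  }
nqueens-resolution {c} {A = A@(fn _ (_ ∷ _))} {ρ = ρ} (there (here refl)) ρ-inj g-ground θ-unifies = record
  { linearised   = pinnedHead (renamed-AtMostOnceExcept ρ-inj 0 (head c)) (headVars⊆ (rename ρ c))
  ; body-linear  = renamed-body-AtMostOnce ρ-inj (body c)
  ; body-grounds = λ { (here refl) → pinned-ground ; (there (here refl)) → trans (++-identityʳ _) pinned-ground }
  }
  where open Pinning A (head (rename ρ c)) g-ground θ-unifies (here refl)
nqueens-resolution {c} {A = A@(fn _ (_ ∷ _))} {ρ = ρ} (there (there (here refl))) ρ-inj g-ground θ-unifies = record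
  { linearised   = pinnedHead (renamed-AtMostOnceExcept ρ-inj 0 (head c)) (headVars⊆ (rename ρ c))
  ; body-linear  = λ ()
  ; body-grounds = λ ()
  }
  where open Pinning A (head (rename ρ c)) g-ground θ-unifies (here refl)
nqueens-resolution {c} {A = A@(fn _ (_ ∷ _))} {ρ = ρ} (there (there (there (here refl)))) ρ-inj g-ground θ-unifies = record
  { linearised   = pinnedHead (renamed-AtMostOnceExcept ρ-inj 0 (head c)) (headVars⊆ (rename ρ c))
  ; body-linear  = renamed-body-AtMostOnce ρ-inj (body c)
  ; body-grounds = λ { (here refl) → pinned-ground }
  }
  where open Pinning A (head (rename ρ c)) g-ground θ-unifies (here refl)

resolution-step : ∀ {Q hist} pre A post c ρ θ → c ∈ nqueens → Injective _≡_ _≡_ ρ →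
  Q ≡ pre ++ A ∷ post → Apart (rename ρ c) (Q ∷ hist) → MGU θ A (head (rename ρ c)) →
  All LinearGroundInput Q → All LinearGroundInput (applyL θ (pre ++ body (rename ρ c) ++ post))
resolution-step {Q} pre A post c ρ θ c∈ ρ-inj refl apart mgu Q-inv =
  All-applyL θ (pre ++ body (rename ρ c) ++ post) resolvent-atom
  where
    clauseVars = varsC (rename ρ c)
    A∈Q = ∈-++⁺ʳ pre (here refl)
    A-inv = All.lookup Q-inv A∈Q

    Q-apart : ∀ {B} → B ∈ Q → ∀ {w} → w ∈ vars B → w ∉ clauseVars
    Q-apart B∈ w∈B w∈c = apart _ w∈c Q (here refl) (vars-⊆-varsL Q B∈ w∈B)

    open ResolutionData (nqueens-resolution c∈ ρ-inj (proj₂ A-inv) (proj₁ mgu))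
    open MGULinearity mgu (proj₁ A-inv) (λ w∈c w∈A → Q-apart A∈Q w∈A w∈c) linearised

    query-atom : ∀ {B} → B ∈ Q → LinearGroundInput (apply θ B)
    query-atom {B} B∈ = mgu-linear-outside B (proj₁ (All.lookup Q-inv B∈)) (Q-apart B∈) ,
                    GroundInput-apply θ _ (proj₂ (All.lookup Q-inv B∈))

    body-atom : ∀ {b} → b ∈ body (rename ρ c) → LinearGroundInput (apply θ b)
    body-atom {b} b∈ = mgu-linear-inside b (body-linear b∈) (∈-++⁺ʳ (vars (head (rename ρ c))) ∘ vars-⊆-varsL _ b∈) ,
                   body-grounds b∈

    resolvent-atom : ∀ {t} → t ∈ pre ++ body (rename ρ c) ++ post → LinearGroundInput (apply θ t)
    resolvent-atom t∈ with ∈-++⁻ pre t∈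
    ... | inj₁ t∈pre = query-atom (∈-++⁺ˡ t∈pre)
    ... | inj₂ t∈rest with ∈-++⁻ (body (rename ρ c)) t∈rest
    ...   | inj₁ t∈body = body-atom t∈body
    ...   | inj₂ t∈post = query-atom (∈-++⁺ʳ pre (there t∈post))

derivation-invariant : ∀ {Q₀} → All LinearGroundInput Q₀ → ∀ {Q hist} → Deriv nqueens Q₀ (Q ∷ hist) → All LinearGroundInput Q
derivation-invariant Q₀-inv start = Q₀-inv
derivation-invariant Q₀-inv (step d pre A post c ρ θ c∈ ρ-inj Q≡ apart mgu) =
  resolution-step pre A post c ρ θ c∈ ρ-inj Q≡ apart mgu (derivation-invariant Q₀-inv d)

corollary4 : ∀ (n t₁ t₂ t₃ : Term) → Ground n → Linear (pqs n t₁ t₂ t₃) →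
    OccurCheckFree nqueens (pqs n t₁ t₂ t₃ ∷ [])
-- The unification is NSTO whether or not the predicate symbols agree.
corollary4 n t₁ t₂ t₃ n-ground linear Q hist d A A∈Q c c∈ ρ ρ-inj apart _ =
  linear-disjoint⇒NSTO A (head (rename ρ c)) (proj₁ (All.lookup Q-inv A∈Q))
    (λ w∈A w∈H → apart _ (headVars⊆ (rename ρ c) w∈H) Q (here refl) (vars-⊆-varsL Q A∈Q w∈A))
  where
    Q-inv = derivation-invariant ((Unique⇒AtMostOnce linear , n-ground) ∷ []) d
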